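{- The quotient complex $\Delta(B_6)/S_3\wr S_2$ is not shellable.
   Context: $B_6$ is the Boolean algebra of subsets of $\{1,\dots,6\}$, and $\Delta(B_6)$ is the order complex of its proper part. The wreath product $S_3\wr S_2\subseteq S_6$ is the group of permutations of $\{1,\dots,6\}$ preserving the partition into the two rows $\{1,2,3\}$ and $\{4,5,6\}$ (permuting within rows and swapping rows); it acts on $B_6$ and on chains. $\Delta(B_6)/S_3\wr S_2$ is the boolean cell complex whose faces are orbits of chains. Shellable means there is an ordering $F_1,\dots,F_k$ of the facets with $F_j\cap(\bigcup_{i<j}F_i)$ pure of codimension one in $F_j$ for each $j>1$. -}

module Defs where

open import Data.Nat using (ℕ; zero; suc; _+_; _<_)
open import Data.Fin using (Fin; toℕ)
open import Data.Fin.Subset using (Subset; _⊂_; ⊥; ⊤)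
open import Data.Fin.Permutation using (Permutation′; _⟨$⟩ʳ_; _⟨$⟩ˡ_)
open import Data.Vec using (tabulate; lookup)
open import Data.List using (List; map; length; take)
open import Data.List.Relation.Unary.All using (All)
open import Data.List.Relation.Unary.Any using (Any)
open import Data.List.Relation.Unary.AllPairs using (AllPairs)
open import Data.List.Relation.Unary.Linked using (Linked)
open import Data.List.Relation.Binary.Sublist.Propositional using (_⊆_)
open import Data.List.Membership.Propositional using (_∈_)
open import Data.Product using (Σ; _×_; ∃; ∃-syntax)
open import Relation.Binary.PropositionalEquality using (_≡_; _≢_)
open import Relation.Nullary using (¬_)

-- Ground set {1,…,n} is represented by Fin n; elements of B_n are Subset n.
-- A face (chain) is represented canonically as a list of subsets that is
-- strictly increasing for ⊂ (so distinct lists = distinct chains), every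
-- element being a nonempty proper subset.  The empty list is the empty face.

Chain : ℕ → Set
Chain n = List (Subset n)

IsChain : ∀ {n} → Chain n → Set
IsChain {n} c = Linked _⊂_ c × All (λ S → S ≢ ⊥ × S ≢ ⊤) c

IsMaxChain : ∀ {n} → Chain n → Set
IsMaxChain {n} c =
  IsChain c ×
  (∀ (c′ : Chain n) → IsChain c′ → (∀ S → S ∈ c → S ∈ c′) → ∀ S → S ∈ c′ → S ∈ c)

-- image of S under g : { g i | i ∈ S }
image : ∀ {n} → Permutation′ n → Subset n → Subset n
image g S = tabulate (λ j → lookup S (g ⟨$⟩ˡ j))

act : ∀ {n} → Permutation′ n → Chain n → Chain n
act g c = map (image g) c

-- A subgroup is given as a predicate on permutations.
-- Two chains lie in the same G-orbit (= are the same face of Δ(B_n)/G).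
SameOrbit : ∀ {n} → (Permutation′ n → Set) → Chain n → Chain n → Set
SameOrbit {n} G c c′ = ∃[ g ] (G g × act g c ≡ c′)

-- Facets are orbits of maximal chains; the faces of the facet [σ] are the
-- orbits [τ] of subchains τ ⊆ σ.  Given earlier facets (representatives),
-- a subchain τ of σ lies in (the closure of) some earlier facet iff
-- [τ] = [τ′] for some subchain τ′ of an earlier representative.

InEarlier : ∀ {n} → (Permutation′ n → Set) → List (Chain n) → Chain n → Set
InEarlier G earlier τ = Any (λ σ′ → ∃[ τ′ ] (τ′ ⊆ σ′ × SameOrbit G τ τ′)) earlier

-- F_j ∩ (⋃_{i<j} F_i), viewed as a subcomplex of the boundary of F_j = [σ],
-- is pure of codimension one in F_j: every face of it lies in a face of it
-- of dimension dim F_j − 1.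
PureCodimOne : ∀ {n} → (Permutation′ n → Set) → List (Chain n) → Chain n → Set
PureCodimOne G earlier σ =
  ∀ τ → τ ⊆ σ → InEarlier G earlier τ →
    ∃[ ρ ] (τ ⊆ ρ × ρ ⊆ σ × suc (length ρ) ≡ length σ × InEarlier G earlier ρ)

IsShelling : ∀ {n} → (Permutation′ n → Set) → List (Chain n) → Set
IsShelling {n} G L =
  All IsMaxChain L ×
  (∀ (c : Chain n) → IsMaxChain c → Any (SameOrbit G c) L) ×
  AllPairs (λ a b → ¬ SameOrbit G a b) L ×
  (∀ (j : Fin (length L)) → 0 < toℕ j →
     PureCodimOne G (take (toℕ j) L) (Data.List.lookup L j))

Shellable : ∀ n → (Permutation′ n → Set) → Set
Shellable n G = ∃[ L ] IsShelling {n} G L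

-- The wreath product S_3 ≀ S_2 ⊆ S_6: rows {0,1,2} and {3,4,5} of Fin 6
-- (i.e. {1,2,3} and {4,5,6}); permutations preserving the row partition.

row : Fin 6 → Fin 2
row i with toℕ i
... | 0 = Fin.zero
... | 1 = Fin.zero
... | 2 = Fin.zero
... | _ = Fin.suc Fin.zero

S3≀S2 : Permutation′ 6 → Set
S3≀S2 g = ∀ i j → row i ≡ row j → row (g ⟨$⟩ʳ i) ≡ row (g ⟨$⟩ʳ j)

-- Row counts, the sizes of the intersections of a subset with the two rows, are preserved by
-- S₃ × S₃ and exchanged by the row swap, and two subsets lie in one orbit as soon as their row
-- counts agree up to order.  So the row counts along a maximal chain form a unit-step lattice path
-- from (0 , 0) to (3 , 3), determined by the orbit of the chain up to swapping coordinates, and the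
-- twenty paths give ten facet types.  In a shelling, consider the set of types of an initial
-- segment and the next facet F.  If some face of F (the empty face, or a vertex whose row counts
-- occur in an earlier facet) lies in an earlier facet while no ridge of F through it does, then
-- purity fails; this is decided on lattice paths alone.  A finite search shows that the sets of
-- types reachable from a single type by adding types that escape this test form a family of 28
-- sets, none of which contains all ten types, so no ordering of the facets is a shelling.

module Submission where

open import Defs
open import Data.Bool using (Bool; true; false; not; _∧_; if_then_else_)
import Data.Bool.Properties as Boolₚ
open import Data.Empty using (⊥-elim)
open import Data.Fin using (Fin; zero; suc; toℕ)
open import Data.Fin.Patterns
import Data.Fin.Properties as Finₚ
open import Data.Fin.Permutation
  using (Permutation′; _⟨$⟩ʳ_; _⟨$⟩ˡ_; inverseˡ; inverseʳ; flip; _∘ₚ_; id; transpose)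
open import Data.Fin.Subset using (Subset; _⊂_; ⁅_⁆; _∪_; ⋃; ∁)
  renaming (⊥ to ∅; ⊤ to Full; _∈_ to _∈ₛ_)
open import Data.Fin.Subset.Properties
  using (anySubset?; _⊂?_; ⊂-trans; ⊂-irref; ⊂-asymmetric; ∉⊥; ∈⊤; ⊥⊆; ⊆⊤; ⊆-antisym; nonempty?;
         Empty-unique; x∈∁p⇒x∉p; x∉∁p⇒x∈p; x∈⁅x⁆; x∈⁅y⁆⇒x≡y; x∈p∪q⁺; x∈p∪q⁻;
         ∪-identityˡ; ∪-identityʳ; ∪-assoc)
  renaming (_∈?_ to _∈ₛ?_)
open import Data.List using (List; []; _∷_; [_]; map; _++_; length; take; cartesianProductWith)
import Data.List as List
import Data.List.Properties as Listₚ
open import Data.List.Relation.Unary.All as All using (All; []; _∷_)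
open import Data.List.Relation.Unary.All.Properties using (All¬⇒¬Any; ++⁻ˡ; ++⁻ʳ)
open import Data.List.Relation.Unary.Any as Any using (Any; here; there)
open import Data.List.Relation.Unary.Any.Properties using (¬Any[])
open import Data.List.Relation.Unary.AllPairs using (AllPairs; _∷_)
open import Data.List.Relation.Unary.Linked as Linked using (Linked; []; [-]; _∷_; linked?)
open import Data.List.Relation.Unary.Linked.Properties using (Linked⇒AllPairs)
open import Data.List.Membership.Propositional using (_∈_; _∉_; find; lose)
open import Data.List.Membership.Propositional.Properties using (∈-map⁺; ∈-map⁻; ∈-++⁺ˡ; ∈-++⁺ʳ)
import Data.List.Membership.DecPropositional as DecMembership
open import Data.List.Relation.Binary.Subset.Propositional.Properties using (∷⁺ʳ)
open import Data.List.Relation.Binary.Pointwise using (Pointwise-≡⇒≡)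
open import Data.List.Relation.Binary.Sublist.Propositional using (_⊆_; _∷_; _∷ʳ_; minimum; from∈)
open import Data.List.Relation.Binary.Sublist.Propositional.Properties using (map⁺)
open import Data.List.Relation.Binary.Sublist.Heterogeneous.Properties using (toPointwise)
open import Data.Nat using (ℕ; zero; suc; _+_; _<_; z<s; _<ᵇ_; _⊓_; _⊔_)
import Data.Nat as ℕ
open import Data.Nat.Properties using (+-suc; +-identityʳ; suc-injective; ⊓-comm; ⊔-comm; +-0-commutativeMonoid)
open import Algebra.Properties.CommutativeMonoid.Sum +-0-commutativeMonoid using (sum; sum-permute; sum-cong-≗)
open import Data.Product using (_×_; _,_; proj₂; ∃-syntax; swap)
import Data.Product.Properties as Productₚ
open import Data.Sum using (_⊎_; inj₁; inj₂)
open import Data.Vec using ([]; _∷_; lookup; tabulate)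
import Data.Vec as Vec
import Data.Vec.Properties as Vecₚ
open import Function using (_∘_)
open import Relation.Nullary using (Dec; yes; no; ¬_; does; contradiction)
open import Relation.Nullary.Decidable using (from-yes; ¬?; _×-dec_; _⊎-dec_; _→-dec_; decidable-stable)
open import Relation.Unary using (Pred; Decidable)
open import Relation.Binary.PropositionalEquality hiding ([_])

all-subsets? : ∀ {n p} {P : Pred (Subset n) p} → Decidable P → Dec (∀ S → P S)
all-subsets? P? with anySubset? (¬? ∘ P?)
... | yes (S , ¬PS) = no λ ∀P → ¬PS (∀P S)
... | no ¬∃¬P = yes λ S → decidable-stable (P? S) λ ¬PS → ¬∃¬P (S , ¬PS)

_≟ₛ_ : ∀ {n} (S S′ : Subset n) → Dec (S ≡ S′)
_≟ₛ_ = Vecₚ.≡-dec Boolₚ._≟_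

_≟²_ : (p q : ℕ × ℕ) → Dec (p ≡ q)
_≟²_ = Productₚ.≡-dec ℕ._≟_ ℕ._≟_

_≟ₚ_ : (x y : List (ℕ × ℕ)) → Dec (x ≡ y)
_≟ₚ_ = Listₚ.≡-dec _≟²_

open import Data.List.Relation.Binary.Sublist.DecPropositional _≟²_ using (_⊆?_)
open DecMembership _≟²_ using () renaming (_∈?_ to _∈²?_)
open DecMembership _≟ₚ_ using () renaming (_∈?_ to _∈ₚ?_)
open DecMembership (_≟ₛ_ {6}) using () renaming (_∈?_ to _∈⁶?_)
open DecMembership (_≟ₛ_ {10}) using () renaming (_∈?_ to _∈¹⁰?_)

-- Row counts and the wreath product

indicator : Bool → ℕ
indicator true = 1
indicator false = 0

countWhere : ∀ {n} → (Fin n → Bool) → Subset n → ℕ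
countWhere P S = sum λ i → indicator (lookup S i ∧ P i)

countWhere-cong : ∀ {n} {P Q : Fin n → Bool} → (∀ i → P i ≡ Q i) →
  ∀ S → countWhere P S ≡ countWhere Q S
countWhere-cong P≗Q S = sum-cong-≗ λ i → cong (λ b → indicator (lookup S i ∧ b)) (P≗Q i)

lookup-image : ∀ {n} (g : Permutation′ n) S j → lookup (image g S) j ≡ lookup S (g ⟨$⟩ˡ j)
lookup-image g S j = Vecₚ.lookup∘tabulate _ j

countWhere-image : ∀ {n} (g : Permutation′ n) P S → countWhere P (image g S) ≡ countWhere (P ∘ (g ⟨$⟩ʳ_)) S
countWhere-image g P S = trans (sum-permute _ g) (sum-cong-≗ λ i →
  cong (λ b → indicator (b ∧ P (g ⟨$⟩ʳ i))) (trans (lookup-image g S _) (cong (lookup S) (inverseˡ g))))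

image-∘ : ∀ {n} (g h : Permutation′ n) S → image (g ∘ₚ h) S ≡ image h (image g S)
image-∘ g h S = Vecₚ.tabulate-cong λ j → sym (lookup-image g S (h ⟨$⟩ˡ j))

image-flip : ∀ {n} (g : Permutation′ n) S → image (flip g) (image g S) ≡ S
image-flip g S = trans
  (Vecₚ.tabulate-cong λ j → trans (lookup-image g S _) (cong (lookup S) (inverseˡ g)))
  (Vecₚ.tabulate∘lookup S)

image-Full : ∀ {n} (g : Permutation′ n) → image g Full ≡ Full
image-Full g = trans
  (Vecₚ.tabulate-cong λ j → trans (Vecₚ.lookup-replicate (g ⟨$⟩ˡ j) true) (sym (Vecₚ.lookup-replicate j true)))
  (Vecₚ.tabulate∘lookup Full)

otherRow : Fin 2 → Fin 2
otherRow 0F = 1F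
otherRow 1F = 0F

otherRow-involutive : ∀ r → otherRow (otherRow r) ≡ r
otherRow-involutive 0F = refl
otherRow-involutive 1F = refl

≟-otherRow : ∀ r s → does (otherRow s Finₚ.≟ r) ≡ does (s Finₚ.≟ otherRow r)
≟-otherRow 0F 0F = refl
≟-otherRow 0F 1F = refl
≟-otherRow 1F 0F = refl
≟-otherRow 1F 1F = refl

inRow : Fin 2 → Fin 6 → Bool
inRow r i = does (row i Finₚ.≟ r)

rowCount : Fin 2 → Subset 6 → ℕ
rowCount r = countWhere (inRow r)

rowCounts : Subset 6 → ℕ × ℕ
rowCounts S = rowCount 0F S , rowCount 1F S

data RowAction (g : Permutation′ 6) : Set where
  keepsRows : (∀ i → row (g ⟨$⟩ʳ i) ≡ row i) → RowAction g
  swapsRows : (∀ i → row (g ⟨$⟩ʳ i) ≡ otherRow (row i)) → RowAction g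

rowLeader : Fin 2 → Fin 6
rowLeader 0F = 0F
rowLeader 1F = 3F

row-rowLeader : ∀ i → row (rowLeader (row i)) ≡ row i
row-rowLeader 0F = refl
row-rowLeader 1F = refl
row-rowLeader 2F = refl
row-rowLeader 3F = refl
row-rowLeader 4F = refl
row-rowLeader 5F = refl

rowMap : Permutation′ 6 → Fin 2 → Fin 2
rowMap g r = row (g ⟨$⟩ʳ rowLeader r)

row-image : ∀ {g} (h : Fin 2 → Fin 2) → S3≀S2 g → rowMap g 0F ≡ h 0F → rowMap g 1F ≡ h 1F →
  ∀ i → row (g ⟨$⟩ʳ i) ≡ h (row i)
row-image {g} h g∈ e₀ e₁ i = trans (g∈ i _ (sym (row-rowLeader i))) (on-rows (row i))
  where
  on-rows : ∀ r → rowMap g r ≡ h r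
  on-rows 0F = e₀
  on-rows 1F = e₁

-- Count the image of the full set in row r: a row has three elements, not six.
¬into-one-row : ∀ g r → ¬ (∀ i → row (g ⟨$⟩ʳ i) ≡ r)
¬into-one-row g r into-r = three≢six r (begin
  rowCount r Full                                     ≡⟨ cong (rowCount r) (image-Full g) ⟨
  rowCount r (image g Full)                           ≡⟨ countWhere-image g (inRow r) Full ⟩
  countWhere (inRow r ∘ (g ⟨$⟩ʳ_)) Full               ≡⟨ countWhere-cong (cong (λ s → does (s Finₚ.≟ r)) ∘ into-r) Full ⟩
  countWhere (λ (_ : Fin 6) → does (r Finₚ.≟ r)) Full ∎)
  where
  open ≡-Reasoning
  three≢six : ∀ r → rowCount r Full ≢ countWhere (λ (_ : Fin 6) → does (r Finₚ.≟ r)) Full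
  three≢six 0F ()
  three≢six 1F ()

rowAction : ∀ {g} → S3≀S2 g → RowAction g
rowAction {g} g∈ with rowMap g 0F in e₀ | rowMap g 1F in e₁
... | 0F | 1F = keepsRows (row-image {g} (λ r → r) g∈ e₀ e₁)
... | 1F | 0F = swapsRows (row-image {g} otherRow g∈ e₀ e₁)
... | 0F | 0F = contradiction (row-image {g} (λ _ → 0F) g∈ e₀ e₁) (¬into-one-row g 0F)
... | 1F | 1F = contradiction (row-image {g} (λ _ → 1F) g∈ e₀ e₁) (¬into-one-row g 1F)

rowCounts-image : ∀ {g} → S3≀S2 g →
  (∀ S → rowCounts (image g S) ≡ rowCounts S) ⊎ (∀ S → rowCounts (image g S) ≡ swap (rowCounts S))
rowCounts-image {g} g∈ with rowAction {g} g∈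
... | keepsRows keep = inj₁ λ S → cong₂ _,_ (kept 0F S) (kept 1F S)
  where
  kept : ∀ r S → rowCount r (image g S) ≡ rowCount r S
  kept r S = trans (countWhere-image g (inRow r) S) (countWhere-cong (cong (λ s → does (s Finₚ.≟ r)) ∘ keep) S)
... | swapsRows swp = inj₂ λ S → cong₂ _,_ (swapped 0F S) (swapped 1F S)
  where
  swapped : ∀ r S → rowCount r (image g S) ≡ rowCount (otherRow r) S
  swapped r S = trans (countWhere-image g (inRow r) S)
    (countWhere-cong (λ i → trans (cong (λ s → does (s Finₚ.≟ r)) (swp i)) (≟-otherRow r (row i))) S)

S3≀S2-∘ : ∀ {g h} → S3≀S2 g → S3≀S2 h → S3≀S2 (g ∘ₚ h)
S3≀S2-∘ g∈ h∈ i j e = h∈ _ _ (g∈ i j e)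

S3≀S2-flip : ∀ {g} → S3≀S2 g → S3≀S2 (flip g)
S3≀S2-flip {g} g∈ i j e with rowAction {g} g∈
... | keepsRows keep = trans (back i) (trans e (sym (back j)))
  where
  back : ∀ i → row (g ⟨$⟩ˡ i) ≡ row i
  back i = trans (sym (keep _)) (cong row (inverseʳ g))
... | swapsRows swp = trans (back i) (trans (cong otherRow e) (sym (back j)))
  where
  back : ∀ i → row (g ⟨$⟩ˡ i) ≡ otherRow (row i)
  back i = trans (sym (otherRow-involutive _)) (cong otherRow (trans (sym (swp _)) (cong row (inverseʳ g))))

S3≀S2? : Decidable S3≀S2
S3≀S2? g = Finₚ.all? λ i → Finₚ.all? λ j →
  (row i Finₚ.≟ row j) →-dec (row (g ⟨$⟩ʳ i) Finₚ.≟ row (g ⟨$⟩ʳ j))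

-- Orbits of subsets

symmetricGroupOn : Fin 6 → Fin 6 → Fin 6 → List (Permutation′ 6)
symmetricGroupOn i j k =
  id ∷ transpose i j ∷ transpose j k ∷ transpose i k
     ∷ (transpose i j ∘ₚ transpose j k) ∷ (transpose j k ∘ₚ transpose i j) ∷ []

swapRows : Permutation′ 6
swapRows = transpose 0F 3F ∘ₚ transpose 1F 4F ∘ₚ transpose 2F 5F

wreathElements : List (Permutation′ 6)
wreathElements = cartesianProductWith _∘ₚ_
  (cartesianProductWith _∘ₚ_ (symmetricGroupOn 0F 1F 2F) (symmetricGroupOn 3F 4F 5F)) (id ∷ swapRows ∷ [])

wreathElements⊆S3≀S2 : All S3≀S2 wreathElements
wreathElements⊆S3≀S2 = from-yes (All.all? S3≀S2? wreathElements)

unordered : ℕ × ℕ → ℕ × ℕ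
unordered (a , b) = a ⊓ b , a ⊔ b

unordered-swap : ∀ p → unordered (swap p) ≡ unordered p
unordered-swap (a , b) = cong₂ _,_ (⊓-comm b a) (⊔-comm b a)

initialSegment : ℕ → Subset 3
initialSegment a = tabulate λ j → toℕ j <ᵇ a

canonical : ℕ × ℕ → Subset 6
canonical (a , b) = initialSegment a Vec.++ initialSegment b

opaque
  canonicalise : ∀ S → Any (λ g → image g S ≡ canonical (unordered (rowCounts S))) wreathElements
  canonicalise = from-yes (all-subsets? λ S →
    Any.any? (λ g → image g S ≟ₛ canonical (unordered (rowCounts S))) wreathElements)

unordered-rowCounts⇒orbit : ∀ S S′ → unordered (rowCounts S) ≡ unordered (rowCounts S′) →
  ∃[ g ] (S3≀S2 g × image g S ≡ S′)
unordered-rowCounts⇒orbit S S′ same =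
  let g , g∈ , gS = find (canonicalise S)
      h , h∈ , hS′ = find (canonicalise S′)
      g∈G = All.lookup wreathElements⊆S3≀S2 g∈
      h∈G = All.lookup wreathElements⊆S3≀S2 h∈
      open ≡-Reasoning
  in g ∘ₚ flip h , S3≀S2-∘ {g} {flip h} g∈G (S3≀S2-flip {h} h∈G) ,
     (begin
       image (g ∘ₚ flip h) S        ≡⟨ image-∘ g (flip h) S ⟩
       image (flip h) (image g S)   ≡⟨ cong (image (flip h)) (trans gS (trans (cong canonical same) (sym hS′))) ⟩
       image (flip h) (image h S′)  ≡⟨ image-flip h S′ ⟩
       S′                           ∎)

-- Lattice paths of maximal chains

Step : ℕ × ℕ → ℕ × ℕ → Set
Step (a , b) q = q ≡ (suc a , b) ⊎ q ≡ (a , suc b)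

step? : ∀ p q → Dec (Step p q)
step? (a , b) q = (q ≟² (suc a , b)) ⊎-dec (q ≟² (a , suc b))

-- A path from p to (3 , 3) is recorded by its points strictly between the two endpoints.
PathFrom : ℕ × ℕ → List (ℕ × ℕ) → Set
PathFrom p [] = Step p (3 , 3)
PathFrom p (q ∷ qs) = Step p q × PathFrom q qs

pathsFrom : ℕ → ℕ × ℕ → List (List (ℕ × ℕ))
pathsFrom zero (2 , 3) = [] ∷ []
pathsFrom zero (3 , 2) = [] ∷ []
pathsFrom zero _ = []
pathsFrom (suc n) (a , b) =
  map ((suc a , b) ∷_) (pathsFrom n (suc a , b)) ++ map ((a , suc b) ∷_) (pathsFrom n (a , suc b))

pathsFrom-complete : ∀ {a b} qs → PathFrom (a , b) qs → qs ∈ pathsFrom (length qs) (a , b)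
pathsFrom-complete [] (inj₁ refl) = here refl
pathsFrom-complete [] (inj₂ refl) = here refl
pathsFrom-complete (_ ∷ qs) (inj₁ refl , path) = ∈-++⁺ˡ (∈-map⁺ _ (pathsFrom-complete qs path))
pathsFrom-complete (_ ∷ qs) (inj₂ refl , path) = ∈-++⁺ʳ _ (∈-map⁺ _ (pathsFrom-complete qs path))

length-PathFrom : ∀ {a b} qs → PathFrom (a , b) qs → length qs + a + b ≡ 5
length-PathFrom [] (inj₁ refl) = refl
length-PathFrom [] (inj₂ refl) = refl
length-PathFrom {a} {b} (_ ∷ qs) (inj₁ refl , path) =
  trans (cong (_+ b) (sym (+-suc (length qs) a))) (length-PathFrom qs path)
length-PathFrom {a} {b} (_ ∷ qs) (inj₂ refl , path) =
  trans (sym (+-suc (length qs + a) b)) (length-PathFrom qs path)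

latticePaths : List (List (ℕ × ℕ))
latticePaths = pathsFrom 5 (0 , 0)

latticePaths-complete : ∀ qs → PathFrom (0 , 0) qs → qs ∈ latticePaths
latticePaths-complete qs path = subst (λ n → qs ∈ pathsFrom n (0 , 0)) length≡5 (pathsFrom-complete qs path)
  where
  length≡5 : length qs ≡ 5
  length≡5 = trans (sym (trans (+-identityʳ _) (+-identityʳ _))) (length-PathFrom qs path)

Proper : Subset 6 → Set
Proper S = S ≢ ∅ × S ≢ Full

proper? : ∀ S → Dec (Proper S)
proper? S = ¬? (S ≟ₛ ∅) ×-dec ¬? (S ≟ₛ Full)

⊂⇒≢∅ : ∀ {n} {A B : Subset n} → A ⊂ B → B ≢ ∅
⊂⇒≢∅ (_ , x , x∈B , _) refl = ∉⊥ x∈B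

⊂⇒≢Full : ∀ {n} {A B : Subset n} → A ⊂ B → A ≢ Full
⊂⇒≢Full (_ , x , _ , x∉A) refl = x∉A ∈⊤

≢∅⇒∅⊂ : ∀ {n} {A : Subset n} → A ≢ ∅ → ∅ ⊂ A
≢∅⇒∅⊂ {A = A} A≢∅ with nonempty? A
... | yes (x , x∈A) = ⊥⊆ , x , x∈A , ∉⊥
... | no empty = contradiction (Empty-unique empty) A≢∅

≢Full⇒⊂Full : ∀ {n} {A : Subset n} → A ≢ Full → A ⊂ Full
≢Full⇒⊂Full {A = A} A≢Full with nonempty? (∁ A)
... | yes (x , x∈∁A) = ⊆⊤ , x , ∈⊤ , x∈∁p⇒x∉p x∈∁A
... | no empty = contradiction (⊆-antisym ⊆⊤ λ {x} _ → x∉∁p⇒x∈p λ x∈∁A → empty (x , x∈∁A)) A≢Full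

between : ∀ {n} → Subset n → Subset n → Subset n
between [] [] = []
between (a ∷ A) (b ∷ B) = if not a ∧ b then true ∷ A else a ∷ between A B

opaque
  refine-or-step : ∀ A B → A ⊂ B → (A ⊂ between A B × between A B ⊂ B) ⊎ Step (rowCounts A) (rowCounts B)
  refine-or-step = from-yes (all-subsets? λ A → all-subsets? λ B →
    (A ⊂? B) →-dec (((A ⊂? between A B) ×-dec (between A B ⊂? B)) ⊎-dec step? (rowCounts A) (rowCounts B)))

Saturated : Subset 6 → Chain 6 → Set
Saturated A σ =
  ∀ σ′ → Linked _⊂_ (A ∷ σ′) → All Proper σ′ → (∀ S → S ∈ σ → S ∈ σ′) → ∀ S → S ∈ σ′ → S ∈ σ

head⊂ : ∀ {S S′ : Subset 6} {σ} → Linked _⊂_ (S ∷ σ) → S′ ∈ σ → S ⊂ S′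
head⊂ chain S′∈σ with Linked⇒AllPairs ⊂-trans chain
... | S⊂σ ∷ _ = All.lookup S⊂σ S′∈σ

saturated-tail : ∀ {A S σ} → Saturated A (S ∷ σ) → A ⊂ S → Proper S → Saturated S σ
saturated-tail {S = S} sat A⊂S proper-S σ′ chain proper σ⊆σ′ T T∈σ′
  with sat (S ∷ σ′) (A⊂S ∷ chain) (proper-S ∷ proper) (λ _ → ∷⁺ʳ S (σ⊆σ′ _)) T (there T∈σ′)
... | here refl = contradiction (head⊂ chain T∈σ′) (⊂-irref refl)
... | there T∈σ = T∈σ

saturated⇒path : ∀ A σ → A ≢ Full → Linked _⊂_ (A ∷ σ) → All Proper σ → Saturated A σ →
  PathFrom (rowCounts A) (map rowCounts σ)
saturated⇒path A [] A≢Full _ _ sat with refine-or-step A Full (≢Full⇒⊂Full A≢Full)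
... | inj₂ step = step
... | inj₁ (A⊂C , C⊂Full)
  with sat (between A Full ∷ []) (A⊂C ∷ [-]) ((⊂⇒≢∅ A⊂C , ⊂⇒≢Full C⊂Full) ∷ []) (λ _ ()) _ (here refl)
... | ()
saturated⇒path A (S ∷ σ) _ (A⊂S ∷ chain) (proper-S ∷ proper) sat with refine-or-step A S A⊂S
... | inj₂ step = step , saturated⇒path S σ (proj₂ proper-S) chain proper (saturated-tail sat A⊂S proper-S)
... | inj₁ (A⊂C , C⊂S)
  with sat (between A S ∷ S ∷ σ) (A⊂C ∷ C⊂S ∷ chain) ((⊂⇒≢∅ A⊂C , ⊂⇒≢Full C⊂S) ∷ proper-S ∷ proper)
           (λ _ → there) _ (here refl)
... | here C≡S = contradiction C⊂S (⊂-irref C≡S)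
... | there C∈σ = contradiction (head⊂ chain C∈σ) (⊂-asymmetric C⊂S)

∅∷-chain : ∀ {σ} → Linked _⊂_ σ → All Proper σ → Linked _⊂_ (∅ ∷ σ)
∅∷-chain [] [] = [-]
∅∷-chain chain ((S≢∅ , _) ∷ _) = ≢∅⇒∅⊂ S≢∅ ∷ chain

maxChain⇒path : ∀ {σ} → IsMaxChain σ → PathFrom (0 , 0) (map rowCounts σ)
maxChain⇒path {σ} ((chain , proper) , maximal) =
  saturated⇒path ∅ σ (λ ()) (∅∷-chain chain proper) proper
    λ σ′ chain′ proper′ → maximal σ′ (Linked.tail chain′ , proper′)

-- Facet types

-- A facet type is a lattice path up to swapping the coordinates; we use the representative
-- whose first step is (1 , 0).
typePaths : Vec.Vec (List (ℕ × ℕ)) 10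
typePaths = Vec.fromList (map ((1 , 0) ∷_) (pathsFrom 4 (1 , 0)))

typePath : Fin 10 → List (ℕ × ℕ)
typePath = lookup typePaths

orientations : List (ℕ × ℕ) → List (List (ℕ × ℕ))
orientations x = x ∷ map swap x ∷ []

-- The fallback 0F is never reached on lattice paths, by latticePaths-typed below.
typeOf : List (ℕ × ℕ) → Fin 10
typeOf x with Finₚ.any? (λ k → x ∈ₚ? orientations (typePath k))
... | yes (k , _) = k
... | no _ = 0F

typ : Chain 6 → Fin 10
typ σ = typeOf (map rowCounts σ)

opaque
  typeOf-orientations : ∀ k → All (λ x → typeOf x ≡ k) (orientations (typePath k))
  typeOf-orientations =
    from-yes (Finₚ.all? λ k → All.all? (λ x → typeOf x Finₚ.≟ k) (orientations (typePath k)))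

  latticePaths-typed : All (λ x → x ∈ orientations (typePath (typeOf x))) latticePaths
  latticePaths-typed = from-yes (All.all? (λ x → x ∈ₚ? orientations (typePath (typeOf x))) latticePaths)

maxChain-typed : ∀ {σ} → IsMaxChain σ → map rowCounts σ ∈ orientations (typePath (typ σ))
maxChain-typed max = All.lookup latticePaths-typed (latticePaths-complete _ (maxChain⇒path max))

map-swap-involutive : ∀ {A B : Set} (x : List (A × B)) → map swap (map swap x) ≡ x
map-swap-involutive x = trans (sym (Listₚ.map-∘ x)) (Listₚ.map-id x)

orientations-swap : ∀ {x y} → x ∈ orientations y → map swap x ∈ orientations y
orientations-swap (here refl) = there (here refl)
orientations-swap {y = y} (there (here refl)) = here (map-swap-involutive y)

orientations-trans : ∀ {x y z} → x ∈ orientations y → y ∈ orientations z → x ∈ orientations z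
orientations-trans (here refl) y∈ = y∈
orientations-trans (there (here refl)) y∈ = orientations-swap y∈

orientation-act : ∀ {g} → S3≀S2 g → ∀ σ → map rowCounts (act g σ) ∈ orientations (map rowCounts σ)
orientation-act {g} g∈ σ with rowCounts-image {g} g∈
... | inj₁ keep = here (trans (sym (Listₚ.map-∘ σ)) (Listₚ.map-cong keep σ))
... | inj₂ swp = there (here (trans (sym (Listₚ.map-∘ σ)) (trans (Listₚ.map-cong swp σ) (Listₚ.map-∘ σ))))

facet : Fin 10 → Chain 6
facet k = map canonical (typePath k)

Comparable : Subset 6 → Subset 6 → Set
Comparable S T = S ≡ T ⊎ S ⊂ T ⊎ T ⊂ S

comparable? : ∀ S T → Dec (Comparable S T)
comparable? S T = (S ≟ₛ T) ⊎-dec (S ⊂? T) ⊎-dec (T ⊂? S)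

AllPairs-comparable : ∀ {σ} {S T : Subset 6} → AllPairs _⊂_ σ → S ∈ σ → T ∈ σ → Comparable S T
AllPairs-comparable (_ ∷ _) (here refl) (here refl) = inj₁ refl
AllPairs-comparable (S⊂ ∷ _) (here refl) (there T∈) = inj₂ (inj₁ (All.lookup S⊂ T∈))
AllPairs-comparable (T⊂ ∷ _) (there S∈) (here refl) = inj₂ (inj₂ (All.lookup T⊂ S∈))
AllPairs-comparable (_ ∷ σ⊂) (there S∈) (there T∈) = AllPairs-comparable σ⊂ S∈ T∈

opaque
  facet-path : ∀ k → map rowCounts (facet k) ≡ typePath k
  facet-path = from-yes (Finₚ.all? λ k → map rowCounts (facet k) ≟ₚ typePath k)

  facet-isChain : ∀ k → IsChain (facet k)
  facet-isChain = from-yes (Finₚ.all? λ k → linked? _⊂?_ (facet k) ×-dec All.all? proper? (facet k))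

  facet-saturated : ∀ k S → Proper S → All (Comparable S) (facet k) → S ∈ facet k
  facet-saturated = from-yes (Finₚ.all? λ k → all-subsets? λ S →
    proper? S →-dec (All.all? (comparable? S) (facet k) →-dec S ∈⁶? facet k))

facet-isMaxChain : ∀ k → IsMaxChain (facet k)
facet-isMaxChain k = facet-isChain k , λ σ (chain , proper) facet⊆σ S S∈σ →
  facet-saturated k S (All.lookup proper S∈σ)
    (All.tabulate λ T∈facet → AllPairs-comparable (Linked⇒AllPairs ⊂-trans chain) S∈σ (facet⊆σ _ T∈facet))

typ-facet-orbit : ∀ {g} k σ → S3≀S2 g → act g (facet k) ≡ σ → typ σ ≡ k
typ-facet-orbit {g} k σ g∈ refl = All.lookup (typeOf-orientations k)
  (subst (λ y → map rowCounts σ ∈ orientations y) (facet-path k) (orientation-act {g} g∈ (facet k)))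

typeSet : List (Fin 10) → Subset 10
typeSet ks = ⋃ (map ⁅_⁆ ks)

∈-typeSet⁺ : ∀ {k ks} → k ∈ ks → k ∈ₛ typeSet ks
∈-typeSet⁺ {k} (here refl) = x∈p∪q⁺ (inj₁ (x∈⁅x⁆ k))
∈-typeSet⁺ (there k∈ks) = x∈p∪q⁺ (inj₂ (∈-typeSet⁺ k∈ks))

∈-typeSet⁻ : ∀ {k} ks → k ∈ₛ typeSet ks → k ∈ ks
∈-typeSet⁻ [] k∈ = ⊥-elim (∉⊥ k∈)
∈-typeSet⁻ (k′ ∷ ks) k∈ with x∈p∪q⁻ ⁅ k′ ⁆ (typeSet ks) k∈
... | inj₁ k∈⁅k′⁆ = here (x∈⁅y⁆⇒x≡y k′ k∈⁅k′⁆)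
... | inj₂ k∈ks = there (∈-typeSet⁻ ks k∈ks)

typeSet-++ : ∀ ks ls → typeSet (ks ++ ls) ≡ typeSet ks ∪ typeSet ls
typeSet-++ [] ls = sym (∪-identityˡ _)
typeSet-++ (k ∷ ks) ls = trans (cong (⁅ k ⁆ ∪_) (typeSet-++ ks ls)) (sym (∪-assoc ⁅ k ⁆ _ _))

typesOf : List (Chain 6) → Subset 10
typesOf σs = typeSet (map typ σs)

∈-typesOf⁺ : ∀ {σ σs} → σ ∈ σs → typ σ ∈ₛ typesOf σs
∈-typesOf⁺ σ∈ = ∈-typeSet⁺ (∈-map⁺ typ σ∈)

∈-typesOf⁻ : ∀ {k} σs → k ∈ₛ typesOf σs → ∃[ σ ] (σ ∈ σs × k ≡ typ σ)
∈-typesOf⁻ σs k∈ = ∈-map⁻ typ (∈-typeSet⁻ (map typ σs) k∈)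

typesOf-∷ʳ : ∀ σs σ → typesOf (σs ++ [ σ ]) ≡ typesOf σs ∪ ⁅ typ σ ⁆
typesOf-∷ʳ σs σ = begin
  typeSet (map typ (σs ++ [ σ ]))  ≡⟨ cong typeSet (Listₚ.map-++ typ σs [ σ ]) ⟩
  typeSet (map typ σs ++ [ typ σ ]) ≡⟨ typeSet-++ (map typ σs) [ typ σ ] ⟩
  typesOf σs ∪ (⁅ typ σ ⁆ ∪ ∅)     ≡⟨ cong (typesOf σs ∪_) (∪-identityʳ ⁅ typ σ ⁆) ⟩
  typesOf σs ∪ ⁅ typ σ ⁆           ∎
  where open ≡-Reasoning

covering⇒all-types : ∀ {L} → (∀ c → IsMaxChain c → Any (SameOrbit S3≀S2 c) L) → typesOf L ≡ Full
covering⇒all-types covers = ⊆-antisym ⊆⊤ λ {k} _ →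
  let σ , σ∈ , g , g∈ , gF≡σ = find (covers (facet k) (facet-isMaxChain k))
  in subst (_∈ₛ _) (typ-facet-orbit {g} k σ g∈ gF≡σ) (∈-typesOf⁺ σ∈)

-- Obstructions to purity

ridges : ∀ {A : Set} → List A → List (List A)
ridges [] = []
ridges (x ∷ xs) = xs ∷ map (x ∷_) (ridges xs)

∈-ridges : ∀ {A : Set} {xs ys : List A} → xs ⊆ ys → suc (length xs) ≡ length ys → xs ∈ ridges ys
∈-ridges (_ ∷ʳ xs⊆ys) len = here (Pointwise-≡⇒≡ (toPointwise (suc-injective len) xs⊆ys))
∈-ridges (refl ∷ xs⊆ys) len = there (∈-map⁺ _ (∈-ridges xs⊆ys (suc-injective len)))

-- An obstruction for a new facet with path x against a set E of earlier types is a face of it,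
-- empty or a vertex whose orbit occurs in an earlier facet, such that the row counts of no ridge
-- through it form a subsequence of a path of an earlier type.
VertexOccurs : Subset 10 → ℕ × ℕ → Set
VertexOccurs E v = ∃[ i ] (i ∈ₛ E × unordered v ∈ map unordered (typePath i))

Isolated : Subset 10 → List (ℕ × ℕ) → List (ℕ × ℕ) → Set
Isolated E x y =
  All (λ r → y ⊆ r → ∀ i → i ∈ₛ E → All (λ x′ → ¬ r ⊆ x′) (orientations (typePath i))) (ridges x)

Obstruction : Subset 10 → List (ℕ × ℕ) → Set
Obstruction E x = Isolated E x [] ⊎ Any (λ v → VertexOccurs E v × Isolated E x [ v ]) x

obstruction? : ∀ E x → Dec (Obstruction E x)
obstruction? E x = isolated? [] ⊎-dec Any.any? (λ v → occurs? v ×-dec isolated? [ v ]) x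
  where
  occurs? : ∀ v → Dec (VertexOccurs E v)
  occurs? v = Finₚ.any? λ i → (i ∈ₛ? E) ×-dec (unordered v ∈²? map unordered (typePath i))
  isolated? : ∀ y → Dec (Isolated E x y)
  isolated? y = All.all? (λ r → (y ⊆? r) →-dec Finₚ.all? λ i → (i ∈ₛ? E) →-dec
    All.all? (λ x′ → ¬? (r ⊆? x′)) (orientations (typePath i))) (ridges x)

map-unordered-orientation : ∀ {x y} → x ∈ orientations y → map unordered x ≡ map unordered y
map-unordered-orientation (here refl) = refl
map-unordered-orientation {y = y} (there (here refl)) =
  trans (sym (Listₚ.map-∘ y)) (Listₚ.map-cong unordered-swap y)

sublist-orientation : ∀ {r r′ s : List (ℕ × ℕ)} → r′ ∈ orientations r → r′ ⊆ s →
  Any (r ⊆_) (orientations s)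
sublist-orientation (here refl) r⊆s = here r⊆s
sublist-orientation {r} (there (here refl)) r′⊆s =
  there (here (subst (_⊆ _) (map-swap-involutive r) (map⁺ swap r′⊆s)))

module _ {pre : List (Chain 6)} (pre-max : All IsMaxChain pre) where

  earlier-sublist : ∀ {ρ} → InEarlier S3≀S2 pre ρ →
    ∃[ σ′ ] (σ′ ∈ pre × Any (map rowCounts ρ ⊆_) (orientations (typePath (typ σ′))))
  earlier-sublist {ρ} earlier =
    let σ′ , σ′∈ , ρ′ , ρ′⊆σ′ , g , g∈ , gρ≡ρ′ = find earlier
        ρ′-orientation = subst (λ c → map rowCounts c ∈ orientations (map rowCounts ρ)) gρ≡ρ′
                           (orientation-act {g} g∈ ρ)
        x′ , x′∈ , ρ⊆x′ = find (sublist-orientation ρ′-orientation (map⁺ rowCounts ρ′⊆σ′))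
    in σ′ , σ′∈ , lose (orientations-trans x′∈ (maxChain-typed (All.lookup pre-max σ′∈))) ρ⊆x′

  vertex-earlier : ∀ S → VertexOccurs (typesOf pre) (rowCounts S) → InEarlier S3≀S2 pre [ S ]
  vertex-earlier S (i , i∈ , u∈) =
    let σ′ , σ′∈ , i≡ = ∈-typesOf⁻ pre i∈
        same = trans (Listₚ.map-∘ σ′) (map-unordered-orientation (maxChain-typed (All.lookup pre-max σ′∈)))
        u∈σ′ = subst (unordered (rowCounts S) ∈_) (trans (cong (map unordered ∘ typePath) i≡) (sym same)) u∈
        S′ , S′∈σ′ , u≡ = ∈-map⁻ (unordered ∘ rowCounts) u∈σ′
        g , g∈ , gS≡S′ = unordered-rowCounts⇒orbit S S′ u≡
    in lose σ′∈ ([ S′ ] , from∈ S′∈σ′ , g , g∈ , cong [_] gS≡S′)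

  isolated⇒¬pure : ∀ {σ τ} → τ ⊆ σ → InEarlier S3≀S2 pre τ →
    Isolated (typesOf pre) (map rowCounts σ) (map rowCounts τ) → ¬ PureCodimOne S3≀S2 pre σ
  isolated⇒¬pure {σ} τ⊆σ τ-earlier isolated pure =
    let ρ , τ⊆ρ , ρ⊆σ , ridge , ρ-earlier = pure _ τ⊆σ τ-earlier
        σ′ , σ′∈ , ρ⊆ = earlier-sublist ρ-earlier
        length-ridge = trans (cong suc (Listₚ.length-map rowCounts ρ))
                             (trans ridge (sym (Listₚ.length-map rowCounts σ)))
        ρ-ridge = ∈-ridges (map⁺ rowCounts ρ⊆σ) length-ridge
    in All¬⇒¬Any (All.lookup isolated ρ-ridge (map⁺ rowCounts τ⊆ρ) (typ σ′) (∈-typesOf⁺ σ′∈)) ρ⊆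

  obstruction⇒¬pure : ∀ {σ₀ σ} → σ₀ ∈ pre → Obstruction (typesOf pre) (map rowCounts σ) →
    ¬ PureCodimOne S3≀S2 pre σ
  obstruction⇒¬pure {σ₀} {σ} σ₀∈ (inj₁ isolated) =
    isolated⇒¬pure (minimum σ) (lose σ₀∈ ([] , minimum σ₀ , id , (λ _ _ e → e) , refl)) isolated
  obstruction⇒¬pure σ₀∈ (inj₂ vertex) =
    let v , v∈ , occurs , isolated = find vertex
        S , S∈σ , v≡ = ∈-map⁻ rowCounts v∈
    in isolated⇒¬pure (from∈ S∈σ) (vertex-earlier S (subst (VertexOccurs _) v≡ occurs))
         (subst (λ u → Isolated _ _ [ u ]) v≡ isolated)

-- The closure of the singletons under adding to E any type k some orientation of which has no
-- obstruction against E, found by a computer search.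
reachable : List (Subset 10)
reachable = map typeSet (map [_] (List.allFin 10) ++
  (0F ∷ 1F ∷ []) ∷ (1F ∷ 2F ∷ []) ∷ (1F ∷ 4F ∷ []) ∷ (2F ∷ 5F ∷ []) ∷ (3F ∷ 6F ∷ []) ∷ (4F ∷ 5F ∷ []) ∷ (8F ∷ 9F ∷ []) ∷
  (0F ∷ 1F ∷ 2F ∷ []) ∷ (0F ∷ 1F ∷ 4F ∷ []) ∷ (1F ∷ 2F ∷ 4F ∷ []) ∷
  (1F ∷ 2F ∷ 5F ∷ []) ∷ (1F ∷ 4F ∷ 5F ∷ []) ∷ (2F ∷ 4F ∷ 5F ∷ []) ∷
  (0F ∷ 1F ∷ 2F ∷ 4F ∷ []) ∷ (0F ∷ 1F ∷ 2F ∷ 5F ∷ []) ∷ (0F ∷ 1F ∷ 4F ∷ 5F ∷ []) ∷ (1F ∷ 2F ∷ 4F ∷ 5F ∷ []) ∷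
  (0F ∷ 1F ∷ 2F ∷ 4F ∷ 5F ∷ []) ∷ [])

opaque
  reachable-closed :
    All (λ E → ∀ k → E ∪ ⁅ k ⁆ ∈ reachable ⊎ All (Obstruction E) (orientations (typePath k))) reachable
  reachable-closed = from-yes (All.all? (λ E → Finₚ.all? λ k →
    (E ∪ ⁅ k ⁆ ∈¹⁰? reachable) ⊎-dec All.all? (obstruction? E) (orientations (typePath k))) reachable)

  singleton-reachable : ∀ k → typeSet [ k ] ∈ reachable
  singleton-reachable = from-yes (Finₚ.all? λ k → typeSet [ k ] ∈¹⁰? reachable)

  Full∉reachable : Full ∉ reachable
  Full∉reachable = from-yes (¬? (Full ∈¹⁰? reachable))

-- Shellings

ShellingCondition : List (Chain 6) → Set
ShellingCondition L =
  ∀ (j : Fin (length L)) → 0 < toℕ j → PureCodimOne S3≀S2 (take (toℕ j) L) (List.lookup L j)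

at-split : ∀ {A : Set} {Q : List A → A → Set} pre x rest →
  (∀ j → Q (take (toℕ j) (pre ++ x ∷ rest)) (List.lookup (pre ++ x ∷ rest) j)) → Q pre x
at-split [] x rest Q-all = Q-all zero
at-split {Q = Q} (p ∷ pre) x rest Q-all = at-split {Q = λ ys → Q (p ∷ ys)} pre x rest (λ j → Q-all (suc j))

shelling-at : ∀ σ₀ pre σ rest → ShellingCondition (σ₀ ∷ pre ++ σ ∷ rest) →
  PureCodimOne S3≀S2 (σ₀ ∷ pre) σ
shelling-at σ₀ pre σ rest shelling =
  at-split {Q = λ ys → PureCodimOne S3≀S2 (σ₀ ∷ ys)} pre σ rest λ j → shelling (suc j) z<s

prefix-types-reachable : ∀ {L} → All IsMaxChain L → ShellingCondition L →
  ∀ σ₀ pre rest → L ≡ σ₀ ∷ pre ++ rest → typesOf (σ₀ ∷ pre) ∈ reachable → typesOf L ∈ reachable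
prefix-types-reachable _ _ σ₀ pre [] refl reachable-pre =
  subst (λ l → typesOf (σ₀ ∷ l) ∈ reachable) (sym (Listₚ.++-identityʳ pre)) reachable-pre
prefix-types-reachable max shelling σ₀ pre (σ ∷ rest) refl reachable-pre =
  extend (All.lookup reachable-closed reachable-pre (typ σ))
  where
  E = typesOf (σ₀ ∷ pre)
  extend : E ∪ ⁅ typ σ ⁆ ∈ reachable ⊎ All (Obstruction E) (orientations (typePath (typ σ))) →
    typesOf (σ₀ ∷ pre ++ σ ∷ rest) ∈ reachable
  extend (inj₁ extended) =
    prefix-types-reachable max shelling σ₀ (pre ++ [ σ ]) rest
      (cong (σ₀ ∷_) (sym (Listₚ.++-assoc pre [ σ ] rest)))
      (subst (_∈ reachable) (sym (typesOf-∷ʳ (σ₀ ∷ pre) σ)) extended)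
  extend (inj₂ obstructed) = ⊥-elim (obstruction⇒¬pure (++⁻ˡ (σ₀ ∷ pre) max) (here refl)
    (All.lookup obstructed (maxChain-typed (All.head (++⁻ʳ (σ₀ ∷ pre) max))))
    (shelling-at σ₀ pre σ rest shelling))

mainTheorem5 : ¬ Shellable 6 S3≀S2
mainTheorem5 ([] , _ , covers , _) = ¬Any[] (covers (facet 0F) (facet-isMaxChain 0F))
mainTheorem5 (σ₀ ∷ rest , max , covers , _ , shelling) =
  Full∉reachable (subst (_∈ reachable) (covering⇒all-types covers)
    (prefix-types-reachable max shelling σ₀ [] rest refl (singleton-reachable (typ σ₀))))
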